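{- Let $(T;<)$ be a condensed tree. Then (1) it is pathwise complete iff it is weakly branching complete and weakly branching point complete; (2) it is complete iff it is branching complete and weakly branching point complete.
   Context: A tree is a set $T$ with a strict partial order $<$ such that for every $x\in T$ the set $\{y:y<x\}$ is linearly ordered, and any two nodes have a common lower bound (no well-foundedness or root assumed). A path is a maximal linearly ordered set of nodes. A bridge is a non-empty convex chain $\mathsf{J}$ such that for every path $\mathsf{P}$ either $\mathsf{J}\subseteq\mathsf{P}$ or $\mathsf{J}\cap\mathsf{P}=\emptyset$; the tree is condensed if all its maximal bridges are singletons. Complete: every non-empty set bounded below has an infimum. Pathwise complete: for every path $\mathsf{P}$ and non-empty $X\subseteq\mathsf{P}$ bounded below, $X$ has an infimum in $\mathsf{P}$. Branching complete: every pair of incomparable nodes has an infimum. Weakly branching complete: for any distinct paths $\mathsf{P},\mathsf{Q}$, $\mathsf{P}\cap\mathsf{Q}$ has a supremum in $\mathsf{P}$ and in $\mathsf{Q}$. A weakly branching point is a node that, for some distinct paths $\mathsf{P},\mathsf{Q}$, is the supremum in $\mathsf{P}$ of $\mathsf{P}\cap\mathsf{Q}$. Weakly branching point complete: for every path $\mathsf{P}$ and non-empty set $X$ of weakly branching points on $\mathsf{P}$, if $X$ is bounded below (resp. above) it has an infimum (resp. supremum) in $\mathsf{P}$. -}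

module Defs where

open import Level using (Level; Setω)
open import Data.Product using (Σ; Σ-syntax; ∃; _×_; _,_)
open import Data.Sum using (_⊎_)
open import Data.Empty using (⊥)
open import Relation.Nullary using (¬_; Dec)
open import Relation.Unary using (Pred; _∈_; _⊆_)
open import Relation.Binary.PropositionalEquality using (_≡_)

Subset : Set → Set₁
Subset A = Pred A Level.zero

-- Classical metatheory (the paper works in ZFC), as explicit hypotheses.

LEM : Setω
LEM = ∀ {ℓ : Level} (P : Set ℓ) → Dec P

IsChainR : {A : Set} → (A → A → Set) → Subset A → Set
IsChainR _<_ C = ∀ {x y} → x ∈ C → y ∈ C → (x < y) ⊎ (x ≡ y) ⊎ (y < x)

IsMaxChainR : {A : Set} → (A → A → Set) → Subset A → Set₁
IsMaxChainR {A} _<_ C = IsChainR _<_ C × (∀ (D : Subset A) → IsChainR _<_ D → C ⊆ D → D ⊆ C)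

HausdorffMaximality : Set₁
HausdorffMaximality =
  ∀ (A : Set) (_<_ : A → A → Set) (C : Subset A) → IsChainR _<_ C →
  Σ[ D ∈ Subset A ] (C ⊆ D × IsMaxChainR _<_ D)

module TreeNotions {T : Set} (_<_ : T → T → Set) where

  _≤_ : T → T → Set
  x ≤ y = (x < y) ⊎ (x ≡ y)

  record IsTree : Set where
    field
      irrefl : ∀ {x} → ¬ (x < x)
      trans  : ∀ {x y z} → x < y → y < z → x < z
      predLinear : ∀ {x y z} → y < x → z < x → (y < z) ⊎ (y ≡ z) ⊎ (z < y)
      commonLower : ∀ x y → Σ[ z ∈ T ] (z ≤ x × z ≤ y)

  IsChain : Subset T → Set
  IsChain = IsChainR _<_

  IsPath : Subset T → Set₁
  IsPath = IsMaxChainR _<_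

  Nonempty : Subset T → Set
  Nonempty X = Σ[ x ∈ T ] x ∈ X

  Disjoint : Subset T → Subset T → Set
  Disjoint X Y = ∀ {x} → x ∈ X → x ∈ Y → ⊥

  _∩_ : Subset T → Subset T → Subset T
  (X ∩ Y) x = x ∈ X × x ∈ Y

  Distinct : Subset T → Subset T → Set
  Distinct P Q = ¬ (P ⊆ Q × Q ⊆ P)

  IsConvex : Subset T → Set
  IsConvex J = ∀ {x y z} → x ∈ J → z ∈ J → x < y → y < z → y ∈ J

  IsBridge : Subset T → Set₁
  IsBridge J = Nonempty J × IsConvex J × IsChain J ×
               (∀ (P : Subset T) → IsPath P → (J ⊆ P) ⊎ Disjoint J P)

  IsMaximalBridge : Subset T → Set₁
  IsMaximalBridge J = IsBridge J × (∀ (K : Subset T) → IsBridge K → J ⊆ K → K ⊆ J)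

  IsSingleton : Subset T → Set
  IsSingleton J = Nonempty J × (∀ {x y} → x ∈ J → y ∈ J → x ≡ y)

  Condensed : Set₁
  Condensed = ∀ (J : Subset T) → IsMaximalBridge J → IsSingleton J

  IsLowerBound : Subset T → T → Set
  IsLowerBound X m = ∀ {x} → x ∈ X → m ≤ x

  IsUpperBound : Subset T → T → Set
  IsUpperBound X m = ∀ {x} → x ∈ X → x ≤ m

  BoundedBelow : Subset T → Set
  BoundedBelow X = Σ[ l ∈ T ] IsLowerBound X l

  IsInf : Subset T → T → Set
  IsInf X m = IsLowerBound X m × (∀ l → IsLowerBound X l → l ≤ m)

  HasInf : Subset T → Set
  HasInf X = Σ[ m ∈ T ] IsInf X m

  IsInfIn : Subset T → Subset T → T → Set
  IsInfIn P X m = m ∈ P × IsLowerBound X m × (∀ l → l ∈ P → IsLowerBound X l → l ≤ m)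

  IsSupIn : Subset T → Subset T → T → Set
  IsSupIn P X m = m ∈ P × IsUpperBound X m × (∀ u → u ∈ P → IsUpperBound X u → m ≤ u)

  HasInfIn : Subset T → Subset T → Set
  HasInfIn P X = Σ[ m ∈ T ] IsInfIn P X m

  HasSupIn : Subset T → Subset T → Set
  HasSupIn P X = Σ[ m ∈ T ] IsSupIn P X m

  BoundedBelowIn : Subset T → Subset T → Set
  BoundedBelowIn P X = Σ[ l ∈ T ] (l ∈ P × IsLowerBound X l)

  BoundedAboveIn : Subset T → Subset T → Set
  BoundedAboveIn P X = Σ[ u ∈ T ] (u ∈ P × IsUpperBound X u)

  Incomparable : T → T → Set
  Incomparable x y = ¬ (x < y) × ¬ (x ≡ y) × ¬ (y < x)

  Pair : T → T → Subset T
  Pair x y z = (z ≡ x) ⊎ (z ≡ y)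

  Complete : Set₁
  Complete = ∀ (X : Subset T) → Nonempty X → BoundedBelow X → HasInf X

  PathwiseComplete : Set₁
  PathwiseComplete = ∀ (P : Subset T) → IsPath P → ∀ (X : Subset T) → X ⊆ P →
                     Nonempty X → BoundedBelow X → HasInfIn P X

  BranchingComplete : Set
  BranchingComplete = ∀ x y → Incomparable x y → HasInf (Pair x y)

  WeaklyBranchingComplete : Set₁
  WeaklyBranchingComplete = ∀ (P Q : Subset T) → IsPath P → IsPath Q → Distinct P Q →
                            HasSupIn P (P ∩ Q) × HasSupIn Q (P ∩ Q)

  IsWeaklyBranchingPoint : T → Set₁
  IsWeaklyBranchingPoint x = Σ[ P ∈ Subset T ] Σ[ Q ∈ Subset T ]
    (IsPath P × IsPath Q × Distinct P Q × IsSupIn P (P ∩ Q) x)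

  WeaklyBranchingPointComplete : Set₁
  WeaklyBranchingPointComplete = ∀ (P : Subset T) → IsPath P → ∀ (X : Subset T) → X ⊆ P →
    Nonempty X → (∀ {x} → x ∈ X → IsWeaklyBranchingPoint x) →
    (BoundedBelowIn P X → HasInfIn P X) × (BoundedAboveIn P X → HasSupIn P X)

-- Paths are downward closed, so for distinct paths P and Q the set P ∩ Q lies
-- below every point of P ∖ Q: pathwise completeness gives its supremum as the
-- infimum of its upper bounds, and branching completeness gives it as the meet
-- of a point of P ∖ Q and a point of Q ∖ P.
--
-- Conversely, if a nonempty subset X of a path P, bounded below, had no infimum
-- in P, then the lower bounds of X would cut P into two parts with no greatest
-- and no least element. Weakly branching point completeness yields a < b on
-- the two sides of this gap with no weakly branching point in [a, b]. A path
-- meeting [a, b] without containing it would branch at a weakly branching point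
-- inside [a, b], so [a, b] is a bridge with two points: impossible in a
-- condensed tree. Finally, under branching completeness the infimum of X is the
-- infimum, along a path through some x₀ ∈ X, of the meets of x₀ with the
-- elements of X.

module Submission where

open import Defs
open import Data.Empty using (⊥; ⊥-elim)
open import Data.Product using (_×_; Σ-syntax; _,_; proj₁; proj₂)
open import Data.Sum using (_⊎_; inj₁; inj₂)
open import Function.Bundles using (_⇔_; mk⇔)
open import Relation.Nullary using (¬_; yes; no)
open import Relation.Nullary.Decidable using (True; toWitness; fromWitness; decidable-stable)
open import Relation.Unary using (_∈_; _∉_; _⊆_; _∖_)
open import Relation.Binary.PropositionalEquality using (_≡_; refl; sym; resp₂)
open import Relation.Binary.PropositionalEquality.Properties using (isEquivalence)
import Relation.Binary.Construct.StrictToNonStrict as StrictToNonStrict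

module TreeTheory {T : Set} {_<_ : T → T → Set} (tree : TreeNotions.IsTree _<_) where
  open TreeNotions _<_
  open IsTree tree
  private module NonStrict = StrictToNonStrict _≡_ _<_

  ≤-refl : ∀ {x} → x ≤ x
  ≤-refl = inj₂ refl

  ≤-trans : ∀ {x y z} → x ≤ y → y ≤ z → x ≤ z
  ≤-trans = NonStrict.trans isEquivalence (resp₂ _<_) trans

  <-≤-trans : ∀ {x y z} → x < y → y ≤ z → x < z
  <-≤-trans = NonStrict.<-≤-trans trans (proj₁ (resp₂ _<_))

  ≤-<-trans : ∀ {x y z} → x ≤ y → y < z → x < z
  ≤-<-trans = NonStrict.≤-<-trans sym trans (proj₂ (resp₂ _<_))

  <-≤-asym : ∀ {x y} → x < y → ¬ (y ≤ x)
  <-≤-asym x<y y≤x = irrefl (<-≤-trans x<y y≤x)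

  Comparable : T → T → Set
  Comparable x y = (x < y) ⊎ (x ≡ y) ⊎ (y < x)

  comparable-sym : ∀ {x y} → Comparable x y → Comparable y x
  comparable-sym (inj₁ x<y)         = inj₂ (inj₂ x<y)
  comparable-sym (inj₂ (inj₁ refl)) = inj₂ (inj₁ refl)
  comparable-sym (inj₂ (inj₂ y<x))  = inj₁ y<x

  module _ {P : Subset T} (P-path : IsPath P) where

    path-comparable : ∀ {x y} → x ∈ P → y ∈ P → Comparable x y
    path-comparable = proj₁ P-path

    -- P ∪ {y} is still a chain, so maximality puts y into P.
    path-downClosed : ∀ {x y} → y ≤ x → x ∈ P → y ∈ P
    path-downClosed (inj₂ refl) x∈P = x∈P
    path-downClosed {x} {y} (inj₁ y<x) x∈P =
      proj₂ P-path (λ z → z ∈ P ⊎ z ≡ y) extended-chain inj₁ (inj₂ refl)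
      where
      comparable-y : ∀ {z} → z ∈ P → Comparable y z
      comparable-y z∈P with path-comparable z∈P x∈P
      ... | inj₁ z<x         = predLinear y<x z<x
      ... | inj₂ (inj₁ refl) = inj₁ y<x
      ... | inj₂ (inj₂ x<z)  = inj₁ (trans y<x x<z)

      extended-chain : IsChain (λ z → z ∈ P ⊎ z ≡ y)
      extended-chain (inj₁ u∈P)  (inj₁ v∈P)  = path-comparable u∈P v∈P
      extended-chain (inj₁ u∈P)  (inj₂ refl) = comparable-sym (comparable-y u∈P)
      extended-chain (inj₂ refl) (inj₁ v∈P)  = comparable-y v∈P
      extended-chain (inj₂ refl) (inj₂ refl) = inj₂ (inj₁ refl)

  path-maximal : ∀ {P Q} → IsPath P → IsPath Q → P ⊆ Q → Q ⊆ P
  path-maximal P-path Q-path = proj₂ P-path _ (proj₁ Q-path)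

  distinct-sym : ∀ {P Q} → Distinct P Q → Distinct Q P
  distinct-sym P≠Q (Q⊆P , P⊆Q) = P≠Q (P⊆Q , Q⊆P)

  shared<unshared : ∀ {P Q} → IsPath P → IsPath Q →
                    ∀ {x p} → x ∈ P ∩ Q → p ∈ P ∖ Q → x < p
  shared<unshared P-path Q-path (x∈P , x∈Q) (p∈P , p∉Q) with path-comparable P-path x∈P p∈P
  ... | inj₁ x<p         = x<p
  ... | inj₂ (inj₁ refl) = ⊥-elim (p∉Q x∈Q)
  ... | inj₂ (inj₂ p<x)  = ⊥-elim (p∉Q (path-downClosed Q-path (inj₁ p<x) x∈Q))

  unshared-incomparable : ∀ {P Q} → IsPath P → IsPath Q →
                          ∀ {p q} → p ∈ P ∖ Q → q ∈ Q ∖ P → Incomparable p q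
  unshared-incomparable P-path Q-path (p∈P , p∉Q) (q∈Q , q∉P) =
    (λ p<q → p∉Q (path-downClosed Q-path (inj₁ p<q) q∈Q)) ,
    (λ { refl → p∉Q q∈Q }) ,
    (λ q<p → q∉P (path-downClosed P-path (inj₁ q<p) p∈P))

  bridge-⊆-path : ∀ {K Q} → IsBridge K → IsPath Q → ∀ {z} → z ∈ K → z ∈ Q → K ⊆ Q
  bridge-⊆-path (_ , _ , _ , K-split) Q-path z∈K z∈Q with K-split _ Q-path
  ... | inj₁ K⊆Q     = K⊆Q
  ... | inj₂ K∩Q≡∅   = ⊥-elim (K∩Q≡∅ z∈K z∈Q)

  LowerBoundsIn : Subset T → Subset T → Subset T
  LowerBoundsIn P X l = l ∈ P × IsLowerBound X l

  UpperBoundsIn : Subset T → Subset T → Subset T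
  UpperBoundsIn P X u = u ∈ P × IsUpperBound X u

  least⇒inf : ∀ {X m} → m ∈ X → IsLowerBound X m → IsInf X m
  least⇒inf m∈X m-lb = m-lb , λ _ l-lb → l-lb m∈X

  greatest⇒supIn : ∀ {P X m} → m ∈ P → m ∈ X → IsUpperBound X m → IsSupIn P X m
  greatest⇒supIn m∈P m∈X m-ub = m∈P , m-ub , λ _ _ u-ub → u-ub m∈X

  lowerBound∈⇒infIn : ∀ {P X x} → x ∈ X → x ∈ LowerBoundsIn P X → IsInfIn P X x
  lowerBound∈⇒infIn x∈X (x∈P , x-lb) = x∈P , x-lb , λ _ _ l-lb → l-lb x∈X

  inf⇒infIn : ∀ {P X m} → IsPath P → X ⊆ P → Nonempty X → IsInf X m → IsInfIn P X m
  inf⇒infIn P-path X⊆P (_ , x∈X) (m-lb , m-greatest) =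
    path-downClosed P-path (m-lb x∈X) (X⊆P x∈X) , m-lb , λ l _ → m-greatest l

  infIn-upperBounds⇒supIn : ∀ {P X m} → X ⊆ P → IsInfIn P (UpperBoundsIn P X) m → IsSupIn P X m
  infIn-upperBounds⇒supIn X⊆P (m∈P , m-lb , m-greatest) =
    m∈P ,
    (λ x∈X → m-greatest _ (X⊆P x∈X) (λ (_ , u-ub) → u-ub x∈X)) ,
    (λ _ u∈P u-ub → m-lb (u∈P , u-ub))

  supIn-∩-comm : ∀ {P Q R} → HasSupIn R (P ∩ Q) → HasSupIn R (Q ∩ P)
  supIn-∩-comm (m , m∈R , m-ub , m-least) =
    m , m∈R ,
    (λ (x∈Q , x∈P) → m-ub (x∈P , x∈Q)) ,
    (λ u u∈R u-ub → m-least u u∈R (λ (x∈P , x∈Q) → u-ub (x∈Q , x∈P)))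

  comparable⇒hasInf-pair : ∀ {x y} → Comparable x y → HasInf (Pair x y)
  comparable⇒hasInf-pair (inj₁ x<y) =
    _ , least⇒inf (inj₁ refl) λ { (inj₁ refl) → ≤-refl ; (inj₂ refl) → inj₁ x<y }
  comparable⇒hasInf-pair (inj₂ (inj₁ refl)) =
    _ , least⇒inf (inj₁ refl) λ { (inj₁ refl) → ≤-refl ; (inj₂ refl) → ≤-refl }
  comparable⇒hasInf-pair (inj₂ (inj₂ y<x)) =
    _ , least⇒inf (inj₂ refl) λ { (inj₁ refl) → inj₁ y<x ; (inj₂ refl) → ≤-refl }

  weaklyBranchingPoint-between :
    WeaklyBranchingComplete → ∀ {P Q} → IsPath P → IsPath Q →
    ∀ {y z} → y ∈ P ∩ Q → z ∈ P ∖ Q →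
    Σ[ s ∈ T ] (IsWeaklyBranchingPoint s × y ≤ s × s ≤ z)
  weaklyBranchingPoint-between wbc {P} {Q} P-path Q-path y∈P∩Q z∈P∖Q@(z∈P , z∉Q) =
    branching-at-sup (proj₁ (wbc P Q P-path Q-path P≠Q))
    where
    P≠Q : Distinct P Q
    P≠Q (P⊆Q , _) = z∉Q (P⊆Q z∈P)

    branching-at-sup : HasSupIn P (P ∩ Q) → Σ[ s ∈ T ] (IsWeaklyBranchingPoint s × _ ≤ s × s ≤ _)
    branching-at-sup (s , s-sup@(_ , s-ub , s-least)) =
      s , (P , Q , P-path , Q-path , P≠Q , s-sup) , s-ub y∈P∩Q ,
      s-least _ z∈P (λ x∈P∩Q → inj₁ (shared<unshared P-path Q-path x∈P∩Q z∈P∖Q))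

  Interval : T → T → Subset T
  Interval a b y = a ≤ y × y ≤ b

  Unbranched : Subset T → Set₁
  Unbranched S = ∀ {y} → y ∈ S → ¬ IsWeaklyBranchingPoint y

  record IsGap (P A : Subset T) : Set where
    field
      lower⊆path       : A ⊆ P
      lower-nonempty   : Nonempty A
      upper-nonempty   : Nonempty (P ∖ A)
      lower<upper      : ∀ {a b} → a ∈ A → b ∈ P ∖ A → a < b
      lower-noGreatest : ∀ {a} → a ∈ A → Σ[ a′ ∈ T ] (a′ ∈ A × a < a′)
      upper-noLeast    : ∀ {b} → b ∈ P ∖ A → Σ[ b′ ∈ T ] (b′ ∈ P ∖ A × b′ < b)

  complete⇒branchingComplete : Complete → BranchingComplete
  complete⇒branchingComplete complete x y _ with commonLower x y
  ... | z , z≤x , z≤y =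
    complete (Pair x y) (x , inj₁ refl) (z , λ { (inj₁ refl) → z≤x ; (inj₂ refl) → z≤y })

  complete⇒pathwiseComplete : Complete → PathwiseComplete
  complete⇒pathwiseComplete complete P P-path X X⊆P X-nonempty X-bounded
    with complete X X-nonempty X-bounded
  ... | m , m-inf = m , inf⇒infIn P-path X⊆P X-nonempty m-inf

  pathwiseComplete⇒hasSupIn : PathwiseComplete → ∀ {P} → IsPath P → ∀ {X} → X ⊆ P →
                              Nonempty X → BoundedAboveIn P X → HasSupIn P X
  pathwiseComplete⇒hasSupIn pc P-path X⊆P (_ , x∈X) X-bounded
    with pc _ P-path (UpperBoundsIn _ _) proj₁ X-bounded (_ , λ (_ , u-ub) → u-ub x∈X)
  ... | m , m-inf = m , infIn-upperBounds⇒supIn X⊆P m-inf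

  pathwiseComplete⇒weaklyBranchingPointComplete :
    PathwiseComplete → WeaklyBranchingPointComplete
  pathwiseComplete⇒weaklyBranchingPointComplete pc P P-path X X⊆P X-nonempty _ =
    (λ (l , _ , l-lb) → pc P P-path X X⊆P X-nonempty (l , l-lb)) ,
    pathwiseComplete⇒hasSupIn pc P-path X⊆P X-nonempty

  supIn-∩⇒weaklyBranchingComplete :
    (∀ {P Q} → IsPath P → IsPath Q → Distinct P Q → HasSupIn P (P ∩ Q)) →
    WeaklyBranchingComplete
  supIn-∩⇒weaklyBranchingComplete sup P Q P-path Q-path P≠Q =
    sup P-path Q-path P≠Q , supIn-∩-comm (sup Q-path P-path (distinct-sym P≠Q))

  module Classical (lem : LEM) where

    stable : ∀ {ℓ} {A : Set ℓ} → ¬ ¬ A → A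
    stable = decidable-stable (lem _)

    ⊈⇒∃∖ : ∀ {P Q : Subset T} → ¬ (P ⊆ Q) → Nonempty (P ∖ Q)
    ⊈⇒∃∖ P⊈Q = stable λ P∖Q≡∅ → P⊈Q λ p∈P → stable λ p∉Q → P∖Q≡∅ (_ , p∈P , p∉Q)

    distinctPaths⇒∃∖ : ∀ {P Q} → IsPath P → IsPath Q → Distinct P Q → Nonempty (P ∖ Q)
    distinctPaths⇒∃∖ P-path Q-path P≠Q =
      ⊈⇒∃∖ λ P⊆Q → P≠Q (P⊆Q , path-maximal P-path Q-path P⊆Q)

    ⊆-or-disjoint : ∀ {J Q : Subset T} → (∀ {y z} → y ∈ J ∩ Q → z ∈ J ∖ Q → ⊥) →
                    (J ⊆ Q) ⊎ Disjoint J Q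
    ⊆-or-disjoint {J} {Q} no-split with lem (Nonempty (J ∩ Q))
    ... | yes (_ , y∈J∩Q) = inj₁ λ z∈J → stable λ z∉Q → no-split y∈J∩Q (z∈J , z∉Q)
    ... | no J∩Q≡∅        = inj₂ λ y∈J y∈Q → J∩Q≡∅ (_ , y∈J , y∈Q)

    branchingComplete⇒hasInf-pair : BranchingComplete → ∀ x y → HasInf (Pair x y)
    branchingComplete⇒hasInf-pair bc x y with lem (Comparable x y)
    ... | yes x~y = comparable⇒hasInf-pair x~y
    ... | no x≁y  = bc x y ((λ x<y → x≁y (inj₁ x<y)) ,
                            (λ x≡y → x≁y (inj₂ (inj₁ x≡y))) ,
                            (λ y<x → x≁y (inj₂ (inj₂ y<x))))

    pathwiseComplete⇒weaklyBranchingComplete : PathwiseComplete → WeaklyBranchingComplete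
    pathwiseComplete⇒weaklyBranchingComplete pc = supIn-∩⇒weaklyBranchingComplete supIn-∩
      where
      supIn-∩ : ∀ {P Q} → IsPath P → IsPath Q → Distinct P Q → HasSupIn P (P ∩ Q)
      supIn-∩ P-path Q-path P≠Q
        with distinctPaths⇒∃∖ P-path Q-path P≠Q
           | distinctPaths⇒∃∖ Q-path P-path (distinct-sym P≠Q)
      ... | p , p∈P∖Q@(p∈P , _) | q , (q∈Q , _) with commonLower p q
      ... | z , z≤p , z≤q =
        pathwiseComplete⇒hasSupIn pc P-path proj₁
          (z , path-downClosed P-path z≤p p∈P , path-downClosed Q-path z≤q q∈Q)
          (p , p∈P , λ x∈P∩Q → inj₁ (shared<unshared P-path Q-path x∈P∩Q p∈P∖Q))

    branchingComplete⇒weaklyBranchingComplete : BranchingComplete → WeaklyBranchingComplete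
    branchingComplete⇒weaklyBranchingComplete bc = supIn-∩⇒weaklyBranchingComplete supIn-∩
      where
      supIn-∩ : ∀ {P Q} → IsPath P → IsPath Q → Distinct P Q → HasSupIn P (P ∩ Q)
      supIn-∩ P-path Q-path P≠Q
        with distinctPaths⇒∃∖ P-path Q-path P≠Q
           | distinctPaths⇒∃∖ Q-path P-path (distinct-sym P≠Q)
      ... | p , p∈P∖Q@(p∈P , _) | q , q∈Q∖P@(q∈Q , _)
        with bc p q (unshared-incomparable P-path Q-path p∈P∖Q q∈Q∖P)
      ... | m , m-lb , m-greatest =
        m , greatest⇒supIn m∈P (m∈P , m∈Q) λ x∈P∩Q@(x∈P , x∈Q) → m-greatest _ λ
          { (inj₁ refl) → inj₁ (shared<unshared P-path Q-path x∈P∩Q p∈P∖Q)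
          ; (inj₂ refl) → inj₁ (shared<unshared Q-path P-path (x∈Q , x∈P) q∈Q∖P) }
        where
        m∈P = path-downClosed P-path (m-lb (inj₁ refl)) p∈P
        m∈Q = path-downClosed Q-path (m-lb (inj₂ refl)) q∈Q

    unbranchedInterval⇒bridge : WeaklyBranchingComplete → ∀ {P} → IsPath P →
                                ∀ {a b} → b ∈ P → a ≤ b → Unbranched (Interval a b) →
                                IsBridge (Interval a b)
    unbranchedInterval⇒bridge wbc {P} P-path {a} {b} b∈P a≤b unbranched =
      (_ , ≤-refl , a≤b) ,
      (λ (a≤x , _) (_ , z≤b) x<y y<z → inj₁ (≤-<-trans a≤x x<y) , inj₁ (<-≤-trans y<z z≤b)) ,
      (λ (_ , x≤b) (_ , y≤b) → path-comparable P-path (below-b x≤b) (below-b y≤b)) ,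
      (λ _ Q-path → ⊆-or-disjoint (no-split Q-path))
      where
      below-b : ∀ {y} → y ≤ b → y ∈ P
      below-b y≤b = path-downClosed P-path y≤b b∈P

      no-split : ∀ {Q} → IsPath Q → ∀ {y z} → y ∈ Interval a b ∩ Q → z ∈ Interval a b ∖ Q → ⊥
      no-split Q-path ((a≤y , y≤b) , y∈Q) ((_ , z≤b) , z∉Q)
        with weaklyBranchingPoint-between wbc P-path Q-path (below-b y≤b , y∈Q) (below-b z≤b , z∉Q)
      ... | s , s-wbp , y≤s , s≤z = unbranched (≤-trans a≤y y≤s , ≤-trans s≤z z≤b) s-wbp

    -- IsWeaklyBranchingPoint lands in Set₁; excluded middle turns it into a Subset.
    WeaklyBranchingPoint : Subset T
    WeaklyBranchingPoint y = True (lem (IsWeaklyBranchingPoint y))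

    module Gap (wbpc : WeaklyBranchingPointComplete) {P A} (P-path : IsPath P)
               (gap : IsGap P A) where
      open IsGap gap

      lower-unbranchedTail : Σ[ a ∈ T ] (a ∈ A × Unbranched (λ y → y ∈ A × a ≤ y))
      lower-unbranchedTail with lem (Nonempty (A ∩ WeaklyBranchingPoint))
      ... | no none = a₀ , a₀∈A , λ (y∈A , _) y-wbp → none (_ , y∈A , fromWitness y-wbp)
        where a₀ = proj₁ lower-nonempty; a₀∈A = proj₂ lower-nonempty
      ... | yes some = beyond-sup (proj₂ (wbpc P P-path _ (λ (y∈A , _) → lower⊆path y∈A)
                                     some (λ (_ , y-wbp) → toWitness y-wbp)) bounded)
        where
        bounded : BoundedAboveIn P (A ∩ WeaklyBranchingPoint)
        bounded with upper-nonempty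
        ... | b , b∈P∖A = b , proj₁ b∈P∖A , λ (y∈A , _) → inj₁ (lower<upper y∈A b∈P∖A)

        beyond-sup : HasSupIn P (A ∩ WeaklyBranchingPoint) →
                     Σ[ a ∈ T ] (a ∈ A × Unbranched (λ y → y ∈ A × a ≤ y))
        beyond-sup (v , v∈P , v-ub , v-least) with lem (v ∈ A)
        ... | yes v∈A with lower-noGreatest v∈A
        ...   | a , a∈A , v<a = a , a∈A , λ (y∈A , a≤y) y-wbp →
                  <-≤-asym v<a (≤-trans a≤y (v-ub (y∈A , fromWitness y-wbp)))
        beyond-sup (v , v∈P , v-ub , v-least) | no v∉A with upper-noLeast (v∈P , v∉A)
        ...   | b , b∈P∖A , b<v = ⊥-elim (<-≤-asym b<v
                  (v-least b (proj₁ b∈P∖A) λ (y∈A , _) → inj₁ (lower<upper y∈A b∈P∖A)))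

      upper-unbranchedHead : Σ[ b ∈ T ] (b ∈ P ∖ A × Unbranched (λ y → y ∈ P ∖ A × y ≤ b))
      upper-unbranchedHead with lem (Nonempty ((P ∖ A) ∩ WeaklyBranchingPoint))
      ... | no none = b₀ , b₀∈P∖A , λ (y∈P∖A , _) y-wbp → none (_ , y∈P∖A , fromWitness y-wbp)
        where b₀ = proj₁ upper-nonempty; b₀∈P∖A = proj₂ upper-nonempty
      ... | yes some = below-inf (proj₁ (wbpc P P-path _ (λ ((y∈P , _) , _) → y∈P)
                                    some (λ (_ , y-wbp) → toWitness y-wbp)) bounded)
        where
        bounded : BoundedBelowIn P ((P ∖ A) ∩ WeaklyBranchingPoint)
        bounded with lower-nonempty
        ... | a , a∈A = a , lower⊆path a∈A , λ (y∈P∖A , _) → inj₁ (lower<upper a∈A y∈P∖A)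

        below-inf : HasInfIn P ((P ∖ A) ∩ WeaklyBranchingPoint) →
                    Σ[ b ∈ T ] (b ∈ P ∖ A × Unbranched (λ y → y ∈ P ∖ A × y ≤ b))
        below-inf (w , w∈P , w-lb , w-greatest) with lem (w ∈ A)
        ... | no w∉A with upper-noLeast (w∈P , w∉A)
        ...   | b , b∈P∖A , b<w = b , b∈P∖A , λ (y∈P∖A , y≤b) y-wbp →
                  <-≤-asym b<w (≤-trans (w-lb (y∈P∖A , fromWitness y-wbp)) y≤b)
        below-inf (w , w∈P , w-lb , w-greatest) | yes w∈A with lower-noGreatest w∈A
        ...   | a , a∈A , w<a = ⊥-elim (<-≤-asym w<a
                  (w-greatest a (lower⊆path a∈A) λ (y∈P∖A , _) → inj₁ (lower<upper a∈A y∈P∖A)))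

      unbranchedInterval : Σ[ a ∈ T ] Σ[ b ∈ T ] (b ∈ P × a < b × Unbranched (Interval a b))
      unbranchedInterval with lower-unbranchedTail | upper-unbranchedHead
      ... | a , a∈A , a-tail | b , b∈P∖A@(b∈P , _) , b-head =
        a , b , b∈P , lower<upper a∈A b∈P∖A , unbranched
        where
        unbranched : Unbranched (Interval a b)
        unbranched {y} (a≤y , y≤b) with lem (y ∈ A)
        ... | yes y∈A = a-tail (y∈A , a≤y)
        ... | no y∉A  = b-head ((path-downClosed P-path y≤b b∈P , y∉A) , y≤b)

    lowerBoundsIn-gap : ∀ {P X} → IsPath P → X ⊆ P → Nonempty X → BoundedBelow X →
                        ¬ HasInfIn P X → IsGap P (LowerBoundsIn P X)
    lowerBoundsIn-gap {P} {X} P-path X⊆P (x₀ , x₀∈X) (l , l-lb) no-inf = record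
      { lower⊆path       = proj₁
      ; lower-nonempty   = l , path-downClosed P-path (l-lb x₀∈X) (X⊆P x₀∈X) , l-lb
      ; upper-nonempty   = x₀ , X⊆P x₀∈X , not-lowerBound x₀∈X
      ; lower<upper      = lower<upper
      ; lower-noGreatest = noGreatest
      ; upper-noLeast    = noLeast
      }
      where
      not-lowerBound : ∀ {x} → x ∈ X → x ∉ LowerBoundsIn P X
      not-lowerBound x∈X x∈LB = no-inf (_ , lowerBound∈⇒infIn x∈X x∈LB)

      lower<upper : ∀ {a b} → a ∈ LowerBoundsIn P X → b ∈ P ∖ LowerBoundsIn P X → a < b
      lower<upper (a∈P , a-lb) (b∈P , b∉LB) with path-comparable P-path a∈P b∈P
      ... | inj₁ a<b         = a<b
      ... | inj₂ (inj₁ refl) = ⊥-elim (b∉LB (a∈P , a-lb))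
      ... | inj₂ (inj₂ b<a)  = ⊥-elim (b∉LB (b∈P , λ x∈X → inj₁ (<-≤-trans b<a (a-lb x∈X))))

      noGreatest : ∀ {a} → a ∈ LowerBoundsIn P X →
                   Σ[ a′ ∈ T ] (a′ ∈ LowerBoundsIn P X × a < a′)
      noGreatest {a} a∈LB@(a∈P , a-lb) = stable λ greatest →
        no-inf (a , a∈P , a-lb , λ l′ l′∈P l′-lb → below-a (l′∈P , l′-lb) greatest)
        where
        below-a : ∀ {l′} → l′ ∈ LowerBoundsIn P X →
                  ¬ (Σ[ a′ ∈ T ] (a′ ∈ LowerBoundsIn P X × a < a′)) → l′ ≤ a
        below-a l′∈LB@(l′∈P , _) greatest with path-comparable P-path l′∈P a∈P
        ... | inj₁ l′<a         = inj₁ l′<a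
        ... | inj₂ (inj₁ refl)  = ≤-refl
        ... | inj₂ (inj₂ a<l′)  = ⊥-elim (greatest (_ , l′∈LB , a<l′))

      noLeast : ∀ {b} → b ∈ P ∖ LowerBoundsIn P X →
                Σ[ b′ ∈ T ] (b′ ∈ P ∖ LowerBoundsIn P X × b′ < b)
      noLeast {b} (b∈P , b∉LB) =
        stable λ no-lower → b∉LB (b∈P , λ {x} x∈X → stable λ b≰x →
          no-lower (x , (X⊆P x∈X , not-lowerBound x∈X) , below-b x∈X b≰x))
        where
        below-b : ∀ {x} → x ∈ X → ¬ (b ≤ x) → x < b
        below-b x∈X b≰x with path-comparable P-path (X⊆P x∈X) b∈P
        ... | inj₁ x<b         = x<b
        ... | inj₂ (inj₁ refl) = ⊥-elim (b≰x ≤-refl)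
        ... | inj₂ (inj₂ b<x)  = ⊥-elim (b≰x (inj₁ b<x))

    module _ (hmp : HausdorffMaximality) where

      pathThrough : ∀ x → Σ[ P ∈ Subset T ] (x ∈ P × IsPath P)
      pathThrough x with hmp T _<_ (_≡ x) (λ { refl refl → inj₂ (inj₁ refl) })
      ... | P , x⊆P , P-path = P , x⊆P refl , P-path

      -- The union of all bridges containing J; membership, a Set₁, is brought
      -- down to Set through excluded middle.
      module MaximalBridge {J : Subset T} (J-bridge : IsBridge J) where

        BridgeThrough : T → Set₁
        BridgeThrough y = Σ[ K ∈ Subset T ] (IsBridge K × J ⊆ K × y ∈ K)

        M : Subset T
        M y = True (lem (BridgeThrough y))

        M-intro : ∀ {y} → BridgeThrough y → y ∈ M
        M-intro = fromWitness

        J⊆M : J ⊆ M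
        J⊆M y∈J = M-intro (J , J-bridge , (λ z∈J → z∈J) , y∈J)

        j = proj₁ (proj₁ J-bridge)
        j∈J = proj₂ (proj₁ J-bridge)

        M-split : ∀ Q → IsPath Q → (M ⊆ Q) ⊎ Disjoint M Q
        M-split Q Q-path = ⊆-or-disjoint λ (y∈M , y∈Q) (z∈M , z∉Q) →
          let (K , K-bridge , J⊆K , y∈K) = toWitness y∈M
              (L , L-bridge , J⊆L , z∈L) = toWitness z∈M
              j∈Q = bridge-⊆-path K-bridge Q-path y∈K y∈Q (J⊆K j∈J)
          in z∉Q (bridge-⊆-path L-bridge Q-path (J⊆L j∈J) j∈Q z∈L)

        Q₀ = pathThrough j
        Q₀-path = proj₂ (proj₂ Q₀)

        M⊆Q₀ : M ⊆ proj₁ Q₀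
        M⊆Q₀ with M-split _ Q₀-path
        ... | inj₁ M⊆Q₀ = M⊆Q₀
        ... | inj₂ M∩Q₀≡∅ = ⊥-elim (M∩Q₀≡∅ (J⊆M j∈J) (proj₁ (proj₂ Q₀)))

        -- Both ends lie on the path Q₀ through j, so y is on the same side of
        -- j as one of them and lies in that end's bridge by convexity.
        M-convex : IsConvex M
        M-convex x∈M z∈M x<y y<z
          with toWitness x∈M | toWitness z∈M
             | path-comparable Q₀-path (path-downClosed Q₀-path (inj₁ y<z) (M⊆Q₀ z∈M)) (M⊆Q₀ (J⊆M j∈J))
        ... | K , K-bridge , J⊆K , x∈K | _ | inj₁ y<j =
          M-intro (K , K-bridge , J⊆K , proj₁ (proj₂ K-bridge) x∈K (J⊆K j∈J) x<y y<j)
        ... | _ | _ | inj₂ (inj₁ refl) = J⊆M j∈J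
        ... | _ | L , L-bridge , J⊆L , z∈L | inj₂ (inj₂ j<y) =
          M-intro (L , L-bridge , J⊆L , proj₁ (proj₂ L-bridge) (J⊆L j∈J) z∈L j<y y<z)

        M-maximalBridge : IsMaximalBridge M
        M-maximalBridge =
          ((j , J⊆M j∈J) , M-convex ,
           (λ x∈M y∈M → path-comparable Q₀-path (M⊆Q₀ x∈M) (M⊆Q₀ y∈M)) , M-split) ,
          λ K K-bridge M⊆K y∈K → M-intro (K , K-bridge , (λ z∈J → M⊆K (J⊆M z∈J)) , y∈K)

      condensed⇒bridge-subsingleton : Condensed → ∀ {J} → IsBridge J →
                                      ∀ {x y} → x ∈ J → y ∈ J → x ≡ y
      condensed⇒bridge-subsingleton condensed J-bridge x∈J y∈J =
        proj₂ (condensed M M-maximalBridge) (J⊆M x∈J) (J⊆M y∈J)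
        where open MaximalBridge J-bridge

      condensed⇒interval-branched : WeaklyBranchingComplete → Condensed →
                                    ∀ {P} → IsPath P → ∀ {a b} → b ∈ P → a < b →
                                    ¬ Unbranched (Interval a b)
      condensed⇒interval-branched wbc condensed P-path b∈P a<b unbranched
        with condensed⇒bridge-subsingleton condensed
               (unbranchedInterval⇒bridge wbc P-path b∈P (inj₁ a<b) unbranched)
               (≤-refl , inj₁ a<b) (inj₁ a<b , ≤-refl)
      ... | refl = irrefl a<b

      weaklyBranchingComplete∧PointComplete⇒pathwiseComplete :
        Condensed → WeaklyBranchingComplete → WeaklyBranchingPointComplete →
        PathwiseComplete
      weaklyBranchingComplete∧PointComplete⇒pathwiseComplete condensed wbc wbpc
                                                             P P-path X X⊆P X-nonempty X-bounded =
        stable λ no-inf →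
          let open Gap wbpc P-path (lowerBoundsIn-gap P-path X⊆P X-nonempty X-bounded no-inf)
              (a , b , b∈P , a<b , unbranched) = unbranchedInterval
          in condensed⇒interval-branched wbc condensed P-path b∈P a<b unbranched

      branchingComplete∧pathwiseComplete⇒complete : BranchingComplete → PathwiseComplete → Complete
      branchingComplete∧pathwiseComplete⇒complete bc pc X (x₀ , x₀∈X) (l , l-lb) =
        let (P , x₀∈P , P-path) = pathThrough x₀
            (m , _ , m-lb , m-greatest) =
              pc P P-path MeetsWithx₀ (meet-below-x₀ P-path x₀∈P)
                 (_ , x₀ , x₀∈X , proj₂ (meet x₀)) (l , below-meets l-lb)
        in m ,
           (λ x∈X → ≤-trans (m-lb (_ , x∈X , proj₂ (meet _))) (proj₁ (proj₂ (meet _)) (inj₁ refl))) ,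
           (λ l′ l′-lb →
              m-greatest l′ (path-downClosed P-path (l′-lb x₀∈X) x₀∈P) (below-meets l′-lb))
        where
        meet : ∀ x → HasInf (Pair x x₀)
        meet x = branchingComplete⇒hasInf-pair bc x x₀

        MeetsWithx₀ : Subset T
        MeetsWithx₀ y = Σ[ x ∈ T ] (x ∈ X × IsInf (Pair x x₀) y)

        meet-below-x₀ : ∀ {P} → IsPath P → x₀ ∈ P → MeetsWithx₀ ⊆ P
        meet-below-x₀ P-path x₀∈P (_ , _ , y-lb , _) = path-downClosed P-path (y-lb (inj₂ refl)) x₀∈P

        below-meets : ∀ {l′} → IsLowerBound X l′ → IsLowerBound MeetsWithx₀ l′
        below-meets l′-lb (_ , x∈X , _ , y-greatest) =
          y-greatest _ λ { (inj₁ refl) → l′-lb x∈X ; (inj₂ refl) → l′-lb x₀∈X }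

mainTheorem10 : LEM → HausdorffMaximality →
    (T : Set) (_<_ : T → T → Set) →
    TreeNotions.IsTree _<_ → TreeNotions.Condensed _<_ →
    (TreeNotions.PathwiseComplete _<_ ⇔
      (TreeNotions.WeaklyBranchingComplete _<_ × TreeNotions.WeaklyBranchingPointComplete _<_))
    × (TreeNotions.Complete _<_ ⇔
      (TreeNotions.BranchingComplete _<_ × TreeNotions.WeaklyBranchingPointComplete _<_))
mainTheorem10 lem hmp T _<_ tree condensed =
  mk⇔ (λ pc → pathwiseComplete⇒weaklyBranchingComplete pc ,
              pathwiseComplete⇒weaklyBranchingPointComplete pc)
      (λ (wbc , wbpc) → weaklyBranchingComplete∧PointComplete⇒pathwiseComplete hmp condensed wbc wbpc) ,
  mk⇔ (λ c → complete⇒branchingComplete c ,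
             pathwiseComplete⇒weaklyBranchingPointComplete (complete⇒pathwiseComplete c))
      (λ (bc , wbpc) → branchingComplete∧pathwiseComplete⇒complete hmp bc
         (weaklyBranchingComplete∧PointComplete⇒pathwiseComplete hmp condensed
            (branchingComplete⇒weaklyBranchingComplete bc) wbpc))
  where
  open TreeTheory tree
  open Classical lem
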